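{- Let $a,b_1,b_2,c\in\mathbb{Z}$ with $a\ge 1$, and let $f=ax_1x_2+b_1x_1+b_2x_2+c$. Put $d_1^+=\max\big(1,\lceil\frac{1-b_2}{a}\rceil\big)$ and $d_2^+=\max\big(1,\lceil\frac{1-b_1}{a}\rceil\big)$. Then \[ \min\mathcal{D}_{\ge0}(f)=\min\left\{\Big(d,\max\Big(d_2^+,\Big\lceil\frac{ -(c+b_1d)}{ad+b_2}\Big\rceil\Big)\Big)\ \Big|\ d\in\mathbb{N}_+,\ d_1^+\le d\le\max\Big(d_1^+,\Big\lceil\frac{ -(c+b_2d_2^+)}{ad_2^++b_1}\Big\rceil\Big)\right\}. \]
   Context: $\mathbb{N}_+$ denotes the positive integers. For a polynomial $f\in\mathbb{Z}[x_1,\ldots,x_n]$ and $\mathbf{d}\in\mathbb{Z}^n$, write $f_{\mathbf d}(X)=f(X+\mathbf{d})$, where $X=(x_1,\ldots,x_n)$. Define $\mathcal{D}_{\ge0}(f)=\{\mathbf{d}\in\mathbb{N}_+^n \mid \text{all non-constant coefficients of } f_{\mathbf d}(X) \text{ are positive and } f(\mathbf{d})\ge 0\}$. For $S\subseteq\mathbb{N}^n$, $\min S$ is the set of minimal elements of $S$ under the componentwise partial order ($\mathbf{x}\le\mathbf{y}$ iff $x_i\le y_i$ for all $i$). -}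

module Defs where

open import Data.Nat using (ℕ; suc)
open import Data.Integer using (ℤ; +_; -[1+_]; _+_; _*_; -_; _≤_; _<_; _⊔_; _/ℕ_; 0ℤ; 1ℤ)
open import Data.Product using (_×_; _,_; Σ; proj₁; proj₂)
open import Relation.Binary.PropositionalEquality using (_≡_)

Point : Set
Point = ℤ × ℤ

_≤ₚ_ : Point → Point → Set
(x₁ , x₂) ≤ₚ (y₁ , y₂) = (x₁ ≤ y₁) × (x₂ ≤ y₂)

PSet : Set₁
PSet = Point → Set

minSet : PSet → PSet
minSet S x = S x × (∀ y → S y → y ≤ₚ x → y ≡ x)

-- Ceiling of p / q for q > 0 (floor division `_/ℕ_` negated twice).
-- For q ≤ 0 the value is an arbitrary junk 0; it is only used with q ≥ 1.
⌈_/_⌉ : ℤ → ℤ → ℤ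
⌈ p / + suc k ⌉ = - ((- p) /ℕ suc k)
⌈ p / + 0 ⌉ = 0ℤ
⌈ p / -[1+ k ] ⌉ = 0ℤ

record BiPoly : Set where
  constructor bipoly
  field
    cX1X2 cX1 cX2 c1 : ℤ
open BiPoly public

eval : BiPoly → ℤ → ℤ → ℤ
eval (bipoly a b₁ b₂ c) x₁ x₂ = a * x₁ * x₂ + b₁ * x₁ + b₂ * x₂ + c

-- f_d(X) = f(X + d): expanding a(x₁+d₁)(x₂+d₂) + b₁(x₁+d₁) + b₂(x₂+d₂) + c
-- gives a x₁x₂ + (a d₂ + b₁) x₁ + (a d₁ + b₂) x₂ + f(d).
shift : BiPoly → Point → BiPoly
shift f@(bipoly a b₁ b₂ c) (d₁ , d₂) =
  bipoly a (a * d₂ + b₁) (a * d₁ + b₂) (eval f d₁ d₂)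

D≥0 : BiPoly → PSet
D≥0 f d@(d₁ , d₂) =
  (1ℤ ≤ d₁) × (1ℤ ≤ d₂) ×
  (0ℤ < cX1X2 (shift f d)) × (0ℤ < cX1 (shift f d)) × (0ℤ < cX2 (shift f d)) ×
  (0ℤ ≤ eval f d₁ d₂)

-- A point (x, y) lies in D≥0(f) exactly when d₁⁺ ≤ x and g x ≤ y, where
-- g x = max(d₂⁺, ⌈-(c + b₁x)/(ax + b₂)⌉): D≥0(f) is the region above the graph
-- of g on [d₁⁺, ∞).  Writing U for the upper end of the range of d, the
-- symmetry of f in (x₁, b₁) ↔ (x₂, b₂) gives f(U, d₂⁺) ≥ 0, so g U = d₂⁺ is the
-- least value of g.  Hence every point of D≥0(f) lies above some graph point
-- (d, g d) with d₁⁺ ≤ d ≤ U, and a set and such a coinitial subset have the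
-- same minimal elements.
module Submission where

open import Defs
import Data.Nat as ℕ
open import Data.Integer
  using (ℤ; +_; _+_; _*_; -_; _-_; _≤_; _⊔_; 0ℤ; 1ℤ; _/ℕ_; _≤?_; +≤+)
open import Data.Integer.Properties
open import Data.Integer.DivMod using ([n/ℕd]*d≤n; n<s[n/ℕd]*d)
open import Data.Integer.Tactic.RingSolver using (solve-∀)
open import Data.Product using (_×_; _,_; Σ; proj₂)
open import Data.Product.Function.NonDependent.Propositional using (_×-⇔_)
open import Function.Bundles using (_⇔_; mk⇔; Equivalence)
open import Function.Properties.Equivalence using (⇔-setoid)
open import Function.Construct.Identity using (⇔-id)
open import Level using (0ℓ)
open import Relation.Binary.PropositionalEquality
  using (_≡_; refl; sym; cong; subst; cong₂)
open import Relation.Nullary using (yes; no; contradiction)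
import Relation.Binary.Reasoning.Setoid

≤ₚ-trans : ∀ {p q r} → p ≤ₚ q → q ≤ₚ r → p ≤ₚ r
≤ₚ-trans (x≤y , x≤y′) (y≤z , y≤z′) = ≤-trans x≤y y≤z , ≤-trans x≤y′ y≤z′

≤ₚ-antisym : ∀ {p q} → p ≤ₚ q → q ≤ₚ p → p ≡ q
≤ₚ-antisym (x≤y , x≤y′) (y≤x , y≤x′) = cong₂ _,_ (≤-antisym x≤y y≤x) (≤-antisym x≤y′ y≤x′)

coinitial⇒minSet⇔ : ∀ {S T : PSet} → (∀ p → T p → S p) →
  (∀ q → S q → Σ Point λ t → T t × t ≤ₚ q) →
  ∀ p → minSet S p ⇔ minSet T p
coinitial⇒minSet⇔ {S} {T} T⊆S coinitial p = mk⇔ to from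
  where
  to : minSet S p → minSet T p
  to (Sp , minS) with coinitial p Sp
  ... | t , Tt , t≤p with minS t (T⊆S t Tt) t≤p
  ... | refl = Tt , λ q Tq → minS q (T⊆S q Tq)

  from : minSet T p → minSet S p
  from (Tp , minT) = T⊆S p Tp , minS
    where
    minS : ∀ q → S q → q ≤ₚ p → q ≡ p
    minS q Sq q≤p with coinitial q Sq
    ... | t , Tt , t≤q with minT t Tt (≤ₚ-trans t≤q q≤p)
    ... | refl = ≤ₚ-antisym q≤p t≤q

≤/ℕ⇔*≤ : ∀ y z n .{{_ : ℕ.NonZero n}} → (y ≤ z /ℕ n) ⇔ (y * + n ≤ z)
≤/ℕ⇔*≤ y z n = mk⇔ to from
  where
  to : y ≤ z /ℕ n → y * + n ≤ z
  to y≤q = ≤-trans (*-monoʳ-≤-nonNeg (+ n) y≤q) ([n/ℕd]*d≤n z n)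

  from : y * + n ≤ z → y ≤ z /ℕ n
  from yn≤z with y ≤? z /ℕ n
  ... | yes y≤q = y≤q
  ... | no y≰q = contradiction
    (≤-<-trans (*-monoʳ-≤-nonNeg (+ n) (i<j⇒suc[i]≤j (≰⇒> y≰q)))
               (≤-<-trans yn≤z (n<s[n/ℕd]*d z n)))
    (<-irrefl refl)

neg-≤-swap : ∀ {i j} → (- i ≤ j) ⇔ (- j ≤ i)
neg-≤-swap {i} {j} = mk⇔ (swap i j) (swap j i)
  where
  swap : ∀ i j → - i ≤ j → - j ≤ i
  swap i j -i≤j = subst (- j ≤_) (neg-involutive i) (neg-mono-≤ -i≤j)

⊔-≤⇔ : ∀ {i j k} → (i ⊔ j ≤ k) ⇔ ((i ≤ k) × (j ≤ k))
⊔-≤⇔ {i} {j} = mk⇔ (λ i⊔j≤k → i⊔j≤k⇒i≤k i j i⊔j≤k , i⊔j≤k⇒j≤k i j i⊔j≤k)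
                   (λ (i≤k , j≤k) → ⊔-lub i≤k j≤k)

diff≡⇒≤⇔≤ : ∀ {i j k l} → i - j ≡ k - l → (j ≤ i) ⇔ (l ≤ k)
diff≡⇒≤⇔≤ eq = mk⇔ (transport eq) (transport (sym eq))
  where
  transport : ∀ {i j k l} → i - j ≡ k - l → j ≤ i → l ≤ k
  transport eq j≤i = 0≤i-j⇒j≤i (subst (0ℤ ≤_) eq (i≤j⇒0≤j-i j≤i))

module ⇔-Reasoning = Relation.Binary.Reasoning.Setoid (⇔-setoid 0ℓ)

⌈/⌉≤⇔≤* : ∀ p q x → 1ℤ ≤ q → (⌈ p / q ⌉ ≤ x) ⇔ (p ≤ x * q)
⌈/⌉≤⇔≤* p q@(+ n@(ℕ.suc _)) x _ = begin
  - ((- p) /ℕ n) ≤ x  ≈⟨ neg-≤-swap ⟩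
  - x ≤ (- p) /ℕ n    ≈⟨ ≤/ℕ⇔*≤ (- x) (- p) n ⟩
  - x * q ≤ - p       ≡⟨ cong (_≤ - p) (sym (neg-distribˡ-* x q)) ⟩
  - (x * q) ≤ - p     ≈⟨ neg-≤-swap ⟩
  - - p ≤ x * q       ≡⟨ cong (_≤ x * q) (neg-involutive p) ⟩
  p ≤ x * q           ∎
  where open ⇔-Reasoning
⌈/⌉≤⇔≤* p (+ ℕ.zero) x (+≤+ ())

-- The ring solver does not unfold eval, so identities involving it are stated
-- with eval written out.
eval-swap : ∀ a b₁ b₂ c x y → eval (bipoly a b₁ b₂ c) x y ≡ eval (bipoly a b₂ b₁ c) y x
eval-swap a b₁ b₂ c x y = swap a b₁ b₂ c x y
  where
  swap : ∀ a b₁ b₂ c x y →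
    a * x * y + b₁ * x + b₂ * y + c ≡ a * y * x + b₂ * y + b₁ * x + c
  swap = solve-∀

⌈-value⌉≤⇔0≤eval : ∀ a b₁ b₂ c x y → 1ℤ ≤ a * x + b₂ →
  (⌈ - (c + b₁ * x) / a * x + b₂ ⌉ ≤ y) ⇔ (0ℤ ≤ eval (bipoly a b₁ b₂ c) x y)
⌈-value⌉≤⇔0≤eval a b₁ b₂ c x y 1≤ax+b₂ = begin
  ⌈ - (c + b₁ * x) / a * x + b₂ ⌉ ≤ y  ≈⟨ ⌈/⌉≤⇔≤* _ _ y 1≤ax+b₂ ⟩
  - (c + b₁ * x) ≤ y * (a * x + b₂)    ≈⟨ diff≡⇒≤⇔≤ (rearrange a b₁ b₂ c x y) ⟩
  0ℤ ≤ eval (bipoly a b₁ b₂ c) x y     ∎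
  where
  open ⇔-Reasoning
  rearrange : ∀ a b₁ b₂ c x y →
    y * (a * x + b₂) - (- (c + b₁ * x)) ≡ (a * x * y + b₁ * x + b₂ * y + c) - 0ℤ
  rearrange = solve-∀

1⊔⌈⌉≤⇔positive : ∀ a b x → 1ℤ ≤ a →
  (1ℤ ⊔ ⌈ 1ℤ - b / a ⌉ ≤ x) ⇔ ((1ℤ ≤ x) × (1ℤ ≤ a * x + b))
1⊔⌈⌉≤⇔positive a b x 1≤a = begin
  1ℤ ⊔ ⌈ 1ℤ - b / a ⌉ ≤ x              ≈⟨ ⊔-≤⇔ ⟩
  ((1ℤ ≤ x) × (⌈ 1ℤ - b / a ⌉ ≤ x))    ≈⟨ ⇔-id _ ×-⇔ ⌈/⌉≤⇔≤* _ a x 1≤a ⟩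
  ((1ℤ ≤ x) × (1ℤ - b ≤ x * a))        ≈⟨ ⇔-id _ ×-⇔ diff≡⇒≤⇔≤ (rearrange a b x) ⟩
  ((1ℤ ≤ x) × (1ℤ ≤ a * x + b))        ∎
  where
  open ⇔-Reasoning
  rearrange : ∀ a b x → x * a - (1ℤ - b) ≡ (a * x + b) - 1ℤ
  rearrange = solve-∀

module _ (a b₁ b₂ c : ℤ) (1≤a : 1ℤ ≤ a) where

  f : BiPoly
  f = bipoly a b₁ b₂ c

  d₁⁺ d₂⁺ U : ℤ
  d₁⁺ = 1ℤ ⊔ ⌈ 1ℤ - b₂ / a ⌉
  d₂⁺ = 1ℤ ⊔ ⌈ 1ℤ - b₁ / a ⌉
  U = d₁⁺ ⊔ ⌈ - (c + b₂ * d₂⁺) / a * d₂⁺ + b₁ ⌉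

  g : ℤ → ℤ
  g d = d₂⁺ ⊔ ⌈ - (c + b₁ * d) / a * d + b₂ ⌉

  D≥0⇔ : ∀ x y → D≥0 f (x , y) ⇔ ((d₁⁺ ≤ x) × (g x ≤ y))
  D≥0⇔ x y = mk⇔ to from
    where
    to : D≥0 f (x , y) → (d₁⁺ ≤ x) × (g x ≤ y)
    to (1≤x , 1≤y , _ , 0<ay+b₁ , 0<ax+b₂ , 0≤fxy) =
      Equivalence.from (1⊔⌈⌉≤⇔positive a b₂ x 1≤a) (1≤x , 1≤ax+b₂) ,
      ⊔-lub (Equivalence.from (1⊔⌈⌉≤⇔positive a b₁ y 1≤a) (1≤y , i<j⇒suc[i]≤j 0<ay+b₁))
            (Equivalence.from (⌈-value⌉≤⇔0≤eval a b₁ b₂ c x y 1≤ax+b₂) 0≤fxy)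
      where 1≤ax+b₂ = i<j⇒suc[i]≤j 0<ax+b₂

    from : (d₁⁺ ≤ x) × (g x ≤ y) → D≥0 f (x , y)
    from (d₁⁺≤x , gx≤y) =
      let (1≤x , 1≤ax+b₂) = Equivalence.to (1⊔⌈⌉≤⇔positive a b₂ x 1≤a) d₁⁺≤x
          (d₂⁺≤y , ⌈⌉≤y) = Equivalence.to ⊔-≤⇔ gx≤y
          (1≤y , 1≤ay+b₁) = Equivalence.to (1⊔⌈⌉≤⇔positive a b₁ y 1≤a) d₂⁺≤y
      in 1≤x , 1≤y , suc[i]≤j⇒i<j 1≤a , suc[i]≤j⇒i<j 1≤ay+b₁ , suc[i]≤j⇒i<j 1≤ax+b₂ ,
         Equivalence.to (⌈-value⌉≤⇔0≤eval a b₁ b₂ c x y 1≤ax+b₂) ⌈⌉≤y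

  d₁⁺≤U : d₁⁺ ≤ U
  d₁⁺≤U = i≤i⊔j d₁⁺ _

  g-least-at-U : ∀ x → g U ≤ g x
  g-least-at-U x = ≤-trans gU≤d₂⁺ (i≤i⊔j d₂⁺ _)
    where
    1≤aU+b₂ : 1ℤ ≤ a * U + b₂
    1≤aU+b₂ = proj₂ (Equivalence.to (1⊔⌈⌉≤⇔positive a b₂ U 1≤a) d₁⁺≤U)
    1≤ad₂⁺+b₁ : 1ℤ ≤ a * d₂⁺ + b₁
    1≤ad₂⁺+b₁ = proj₂ (Equivalence.to (1⊔⌈⌉≤⇔positive a b₁ d₂⁺ 1≤a) ≤-refl)
    0≤fUd₂⁺ : 0ℤ ≤ eval f U d₂⁺
    0≤fUd₂⁺ = subst (0ℤ ≤_) (sym (eval-swap a b₁ b₂ c U d₂⁺))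
      (Equivalence.to (⌈-value⌉≤⇔0≤eval a b₂ b₁ c d₂⁺ U 1≤ad₂⁺+b₁) (i≤j⊔i d₁⁺ _))
    gU≤d₂⁺ : g U ≤ d₂⁺
    gU≤d₂⁺ = ⊔-lub ≤-refl
      (Equivalence.from (⌈-value⌉≤⇔0≤eval a b₁ b₂ c U d₂⁺ 1≤aU+b₂) 0≤fUd₂⁺)

  Graph : PSet
  Graph p = Σ ℤ λ d → (1ℤ ≤ d) × (d₁⁺ ≤ d) × (d ≤ U) × (p ≡ (d , g d))

  graph-point : ∀ d → d₁⁺ ≤ d → d ≤ U → Graph (d , g d)
  graph-point d d₁⁺≤d d≤U = d , ≤-trans (i≤i⊔j 1ℤ _) d₁⁺≤d , d₁⁺≤d , d≤U , refl

  Graph⊆D≥0 : ∀ p → Graph p → D≥0 f p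
  Graph⊆D≥0 _ (d , _ , d₁⁺≤d , _ , refl) = Equivalence.from (D≥0⇔ d (g d)) (d₁⁺≤d , ≤-refl)

  D≥0-above-Graph : ∀ q → D≥0 f q → Σ Point λ t → Graph t × t ≤ₚ q
  D≥0-above-Graph (x , y) q∈D with Equivalence.to (D≥0⇔ x y) q∈D | x ≤? U
  ... | d₁⁺≤x , gx≤y | yes x≤U = (x , g x) , graph-point x d₁⁺≤x x≤U , ≤-refl , gx≤y
  ... | d₁⁺≤x , gx≤y | no x≰U  = (U , g U) , graph-point U d₁⁺≤U ≤-refl ,
                                 <⇒≤ (≰⇒> x≰U) , ≤-trans (g-least-at-U x) gx≤y

lemma4p9 : (a b₁ b₂ c : ℤ) → 1ℤ ≤ a →
    let f = bipoly a b₁ b₂ c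
        d₁⁺ = 1ℤ ⊔ ⌈ 1ℤ - b₂ / a ⌉
        d₂⁺ = 1ℤ ⊔ ⌈ 1ℤ - b₁ / a ⌉
        U = d₁⁺ ⊔ ⌈ - (c + b₂ * d₂⁺) / a * d₂⁺ + b₁ ⌉
        T : PSet
        T = λ p → Σ ℤ (λ d → (1ℤ ≤ d) × (d₁⁺ ≤ d) × (d ≤ U) ×
              (p ≡ (d , d₂⁺ ⊔ ⌈ - (c + b₁ * d) / a * d + b₂ ⌉)))
    in ∀ (p : Point) → minSet (D≥0 f) p ⇔ minSet T p
lemma4p9 a b₁ b₂ c 1≤a =
  coinitial⇒minSet⇔ (Graph⊆D≥0 a b₁ b₂ c 1≤a) (D≥0-above-Graph a b₁ b₂ c 1≤a)
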